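{- Let $G$ be a square and let $H$ be any graph. Then the strong product $G\boxtimes H$ is a square.
   Context: $G\boxtimes H$ has vertex set $V(G)\times V(H)$, with $(g,h)$ adjacent to $(g',h')$ iff one of the following holds: $g=g'$ and $hh'\in E(H)$; $h=h'$ and $gg'\in E(G)$; $gg'\in E(G)$ and $hh'\in E(H)$. All graphs are finite, simple, with nonempty vertex sets. A partially labeled graph is a graph $K$ together with an injective map $\theta: L\to V(K)$, $L\subseteq\mathbb{N}$, whose image $\theta(L)$ is nonempty and a proper subset of $V(K)$; vertices in $\theta(L)$ are labeled. The square $KK$ is obtained from two disjoint copies of $K$ by identifying each labeled vertex $\theta(\ell)$ of the first copy with $\theta(\ell)$ of the second copy (keeping all edges, merging double edges). A graph is a square if it is isomorphic to $KK$ for some partially labeled graph $K$. -}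

module Defs where

open import Level using (0ℓ)
open import Data.Nat using (ℕ; suc)
open import Data.Fin using (Fin)
open import Data.Fin.Properties using (*↔×; any?)
open import Data.Bool using (T; not)
open import Data.Empty using (⊥)
open import Data.Product using (Σ; ∃; _×_; _,_; proj₁; proj₂)
open import Data.Product.Function.NonDependent.Propositional using (_×-↔_)
open import Data.Product.Properties using (≡-dec)
open import Data.Sum using (_⊎_; inj₁; inj₂)
open import Function using (_∘_)
open import Function.Bundles using (_↔_; _⇔_; Inverse)
open import Function.Properties.Inverse using (↔-trans; ↔-sym)
open import Relation.Nullary using (¬_; Dec)
open import Relation.Nullary.Decidable using (⌊_⌋)
open import Relation.Binary.Definitions using (DecidableEquality)
open import Relation.Binary.PropositionalEquality using (_≡_; refl; _≢_)

record Graph : Set₁ where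
  field
    V        : Set
    finite   : Σ ℕ (λ n → V ↔ Fin n)
    _≟_      : DecidableEquality V
    nonempty : V
    E        : V → V → Set
    sym      : ∀ {u v} → E u v → E v u
    irrefl   : ∀ {v} → ¬ E v v

_⊠_ : Graph → Graph → Graph
G ⊠ H = record
  { V        = G.V × H.V
  ; finite   = (proj₁ G.finite Data.Nat.* proj₁ H.finite)
             , ↔-trans (proj₂ G.finite ×-↔ proj₂ H.finite) (↔-sym *↔×)
  ; _≟_      = ≡-dec G._≟_ H._≟_
  ; nonempty = G.nonempty , H.nonempty
  ; E        = SE
  ; sym      = SE-sym
  ; irrefl   = SE-irr
  }
  where
  module G = Graph G
  module H = Graph H
  SE : G.V × H.V → G.V × H.V → Set
  SE (g , h) (g′ , h′) =
    ((g ≡ g′) × H.E h h′) ⊎ ((G.E g g′ × h ≡ h′) ⊎ (G.E g g′ × H.E h h′))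
  SE-sym : ∀ {u v} → SE u v → SE v u
  SE-sym (inj₁ (refl , e)) = inj₁ (refl , H.sym e)
  SE-sym (inj₂ (inj₁ (e , refl))) = inj₂ (inj₁ (G.sym e , refl))
  SE-sym (inj₂ (inj₂ (e , f))) = inj₂ (inj₂ (G.sym e , H.sym f))
  SE-irr : ∀ {v} → ¬ SE v v
  SE-irr (inj₁ (_ , e)) = H.irrefl e
  SE-irr (inj₂ (inj₁ (e , _))) = G.irrefl e
  SE-irr (inj₂ (inj₂ (e , _))) = G.irrefl e

-- Since V(K) is finite, the label set L ⊆ ℕ is finite; only
-- the image of θ matters, so we index labels by Fin m (m ≥ 1 makes the image
-- nonempty), and require a vertex outside the image (proper subset).
record PartiallyLabeled : Set₁ where
  field
    K         : Graph
    m         : ℕ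
    θ         : Fin (suc m) → Graph.V K
    θ-inj     : ∀ i j → θ i ≡ θ j → i ≡ j
    proper    : Σ (Graph.V K) (λ v → ∀ i → θ i ≢ v)

  open Graph K

  Labeled : V → Set
  Labeled v = ∃ (λ i → θ i ≡ v)

  isLabeled : V → Data.Bool.Bool
  isLabeled v = ⌊ any? (λ i → θ i ≟ v) ⌋

  -- vertices of the square KK: the whole first copy, plus the unlabeled
  -- vertices of the second copy (labeled ones are identified with the first)
  SqV : Set
  SqV = V ⊎ Σ V (λ v → T (not (isLabeled v)))

  SqE : SqV → SqV → Set
  SqE (inj₁ a) (inj₁ b) = E a b
  SqE (inj₂ (a , _)) (inj₂ (b , _)) = E a b
  SqE (inj₁ a) (inj₂ (b , _)) = Labeled a × E a b
  SqE (inj₂ (a , _)) (inj₁ b) = E a b × Labeled b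

record Iso (G : Graph) (W : Set) (F : W → W → Set) : Set where
  field
    bij : Graph.V G ↔ W
  open Inverse bij
  field
    preserves : ∀ u v → Graph.E G u v ⇔ F (to u) (to v)

IsSquare : Graph → Set₁
IsSquare G = Σ PartiallyLabeled
  (λ P → Iso G (PartiallyLabeled.SqV P) (PartiallyLabeled.SqE P))

{-# OPTIONS --safe #-}
-- If G ≅ KK, then G ⊠ H ≅ (K ⊠ H)(K ⊠ H), where K ⊠ H is labeled on all pairs
-- (θ ℓ , h) with h ∈ V(H): a vertex (v , h) of KK ⊠ H is shared by both copies
-- exactly when v is, i.e. when v is a labeled vertex of K.
module Submission where

open import Defs
open import Level using (0ℓ)
open import Data.Nat using (ℕ; zero; suc; _+_; _*_)
open import Data.Fin using (Fin)
open import Data.Fin.Properties using (¬Fin0; *↔×)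
open import Data.Bool using (T; not)
open import Data.Bool.Properties using (T-irrelevant)
open import Data.Empty using (⊥-elim)
open import Data.Product using (∃; _×_; _,_; proj₁; proj₂; map₁)
open import Data.Product.Properties using (,-injective)
open import Data.Product.Function.NonDependent.Propositional using (_×-↔_)
open import Data.Sum using (_⊎_; inj₁; inj₂)
open import Data.Sum.Properties using (inj₁-injective)
open import Function using (_∘_)
open import Function.Bundles
  using (_↔_; _⇔_; Inverse; Equivalence; Injection; mk⇔; mk↔ₛ′)
open import Function.Properties.Inverse using (↔-refl; ↔-trans; ↔-sym; ↔⇒↣)
open import Function.Properties.Equivalence
  using () renaming (refl to ⇔-refl; sym to ⇔-sym; trans to ⇔-trans)
open import Relation.Binary.Core using (Rel)
open import Relation.Nullary using (¬_)
open import Relation.Nullary.Decidable using (toWitnessFalse; fromWitnessFalse)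
open import Relation.Binary.PropositionalEquality using (_≡_; _≢_; refl; sym; cong; trans)

private
  variable
    A A′ B W W′ : Set
    R : Rel A 0ℓ
    R′ : Rel A′ 0ℓ
    S : Rel B 0ℓ
    x x′ : A
    y y′ : A′
    h h′ : B

-- Graph.E (G ⊠ H) unfolds to Strong (Graph.E G) (Graph.E H).
Strong : Rel A 0ℓ → Rel B 0ℓ → Rel (A × B) 0ℓ
Strong R S (a , b) (a′ , b′) =
  (a ≡ a′ × S b b′) ⊎ ((R a a′ × b ≡ b′) ⊎ (R a a′ × S b b′))

Strong-map : (x ≡ x′ → y ≡ y′) → (R x x′ → R′ y y′) →
             Strong R S (x , h) (x′ , h′) → Strong R′ S (y , h) (y′ , h′)
Strong-map f g (inj₁ (q , s))         = inj₁ (f q , s)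
Strong-map f g (inj₂ (inj₁ (r , q))) = inj₂ (inj₁ (g r , q))
Strong-map f g (inj₂ (inj₂ (r , s))) = inj₂ (inj₂ (g r , s))

Strong-cong : (x ≡ x′ ⇔ y ≡ y′) → (R x x′ ⇔ R′ y y′) →
              Strong R S (x , h) (x′ , h′) ⇔ Strong R′ S (y , h) (y′ , h′)
Strong-cong {R = R} {R′ = R′} {S = S} eq rel =
  mk⇔ (Strong-map {R = R} {R′ = R′} {S = S} (Equivalence.to eq) (Equivalence.to rel))
      (Strong-map {R = R′} {R′ = R} {S = S} (Equivalence.from eq) (Equivalence.from rel))

Iso-transport : ∀ {G} {F : Rel W 0ℓ} {F′ : Rel W′ 0ℓ} → Iso G W F → (f : W ↔ W′) →
                (∀ u v → F u v ⇔ F′ (Inverse.to f u) (Inverse.to f v)) → Iso G W′ F′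
Iso-transport I f pres = record
  { bij       = ↔-trans (Iso.bij I) f
  ; preserves = λ u v → ⇔-trans (Iso.preserves I u v) (pres _ _)
  }

Iso-⊠ : ∀ {G} {F : Rel W 0ℓ} (H : Graph) →
        Iso G W F → Iso (G ⊠ H) (W × Graph.V H) (Strong F (Graph.E H))
Iso-⊠ {G = G} {F = F} H I = record
  { bij       = bij ×-↔ ↔-refl
  ; preserves = λ { (g , h) (g′ , h′) → Strong-cong {R = Graph.E G} {R′ = F} {S = Graph.E H}
                      (mk⇔ (cong to) (Injection.injective (↔⇒↣ bij))) (preserves g g′) }
  }
  where open Iso I; open Inverse bij

map₁-injective : {f : A → A′} → (∀ {a a′} → f a ≡ f a′ → a ≡ a′) →
                 {p q : A × B} → map₁ f p ≡ map₁ f q → p ≡ q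
map₁-injective f-inj {a , b} eq with ,-injective eq
... | fa≡fa′ , refl = cong (_, b) (f-inj fa≡fa′)

module _ (P : PartiallyLabeled) where
  open PartiallyLabeled P

  unlabeled⇔¬labeled : ∀ {v} → T (not (isLabeled v)) ⇔ (¬ Labeled v)
  unlabeled⇔¬labeled = mk⇔ toWitnessFalse fromWitnessFalse

  labeled≢unlabeled : ∀ {a b} → Labeled a → T (not (isLabeled b)) → a ≢ b
  labeled≢unlabeled l u refl = toWitnessFalse u l

  inj₂-cong : ∀ {a b u u′} → a ≡ b → _≡_ {A = SqV} (inj₂ (a , u)) (inj₂ (b , u′))
  inj₂-cong {u = u} {u′} refl = cong (λ u → inj₂ (_ , u)) (T-irrelevant u u′)

module LabeledProduct
  (P : PartiallyLabeled) (H : Graph) {k : ℕ} (enum : Graph.V H ↔ Fin (suc k)) where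
  module P = PartiallyLabeled P
  module K = Graph P.K
  module H = Graph H

  -- suc (k + P.m * suc k) is suc P.m * suc k; this is why H must be nonempty.
  labels : Fin (suc (k + P.m * suc k)) ↔ (Fin (suc P.m) × H.V)
  labels = ↔-trans *↔× (↔-refl ×-↔ ↔-sym enum)

  θ⊠ : Fin (suc (k + P.m * suc k)) → Graph.V P.K × H.V
  θ⊠ = map₁ P.θ ∘ Inverse.to labels

  θ⊠-injective : ∀ i j → θ⊠ i ≡ θ⊠ j → i ≡ j
  θ⊠-injective i j = Injection.injective (↔⇒↣ labels) ∘ map₁-injective (P.θ-inj _ _)

  product : PartiallyLabeled
  product = record
    { K      = P.K ⊠ H
    ; m      = k + P.m * suc k
    ; θ      = θ⊠
    ; θ-inj  = θ⊠-injective
    ; proper = (proj₁ P.proper , H.nonempty) , λ i → proj₂ P.proper _ ∘ cong proj₁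
    }
  module Q = PartiallyLabeled product

  labeled→ : ∀ {a h} → Q.Labeled (a , h) → P.Labeled a
  labeled→ (i , θ⊠i≡ah) = proj₁ (Inverse.to labels i) , cong proj₁ θ⊠i≡ah

  labeled← : ∀ {a h} → P.Labeled a → Q.Labeled (a , h)
  labeled← {h = h} (j , θj≡a) = Inverse.from labels (j , h) ,
    trans (cong (map₁ P.θ) (Inverse.strictlyInverseˡ labels (j , h))) (cong (_, h) θj≡a)

  unlabeled⇔ : ∀ {a h} → T (not (P.isLabeled a)) ⇔ T (not (Q.isLabeled (a , h)))
  unlabeled⇔ = ⇔-trans (unlabeled⇔¬labeled P)
                 (⇔-trans ¬labeled⇔ (⇔-sym (unlabeled⇔¬labeled product)))
    where
    ¬labeled⇔ : ∀ {a h} → (¬ P.Labeled a) ⇔ (¬ Q.Labeled (a , h))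
    ¬labeled⇔ = mk⇔ (_∘ labeled→) (_∘ labeled←)

  square↔ : (P.SqV × H.V) ↔ Q.SqV
  square↔ = mk↔ₛ′ to from to∘from from∘to
    where
    to : P.SqV × H.V → Q.SqV
    to (inj₁ a , h)       = inj₁ (a , h)
    to (inj₂ (a , u) , h) = inj₂ ((a , h) , Equivalence.to unlabeled⇔ u)
    from : Q.SqV → P.SqV × H.V
    from (inj₁ (a , h))       = inj₁ a , h
    from (inj₂ ((a , h) , u)) = inj₂ (a , Equivalence.from unlabeled⇔ u) , h
    to∘from : ∀ y → to (from y) ≡ y
    to∘from (inj₁ _) = refl
    to∘from (inj₂ _) = inj₂-cong product refl
    from∘to : ∀ x → from (to x) ≡ x
    from∘to (inj₁ _ , _) = refl
    from∘to (inj₂ _ , h) = cong (_, h) (inj₂-cong P refl)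

  square-preserves : ∀ u v →
    Strong P.SqE H.E u v ⇔ Q.SqE (Inverse.to square↔ u) (Inverse.to square↔ v)
  square-preserves (inj₁ a , h) (inj₁ b , h′) =
    Strong-cong {R = P.SqE} {R′ = K.E} {S = H.E} (mk⇔ inj₁-injective (cong inj₁)) ⇔-refl
  square-preserves (inj₂ (a , u) , h) (inj₂ (b , u′) , h′) =
    Strong-cong {R = P.SqE} {R′ = K.E} {S = H.E}
      (mk⇔ (λ { refl → refl }) (inj₂-cong P)) ⇔-refl
  square-preserves (inj₁ a , h) (inj₂ (b , u) , h′) = mk⇔ to from
    where
    to : Strong P.SqE H.E (inj₁ a , h) (inj₂ (b , u) , h′) →
         Q.Labeled (a , h) × Strong K.E H.E (a , h) (b , h′)
    to (inj₁ (() , _))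
    to (inj₂ (inj₁ ((l , e) , q))) = labeled← l , inj₂ (inj₁ (e , q))
    to (inj₂ (inj₂ ((l , e) , s))) = labeled← l , inj₂ (inj₂ (e , s))
    from : Q.Labeled (a , h) × Strong K.E H.E (a , h) (b , h′) →
           Strong P.SqE H.E (inj₁ a , h) (inj₂ (b , u) , h′)
    from (l , s) = Strong-map {R = K.E} {R′ = P.SqE} {S = H.E}
      (⊥-elim ∘ labeled≢unlabeled P (labeled→ l) u) (labeled→ l ,_) s
  square-preserves (inj₂ (a , u) , h) (inj₁ b , h′) = mk⇔ to from
    where
    to : Strong P.SqE H.E (inj₂ (a , u) , h) (inj₁ b , h′) →
         Strong K.E H.E (a , h) (b , h′) × Q.Labeled (b , h′)
    to (inj₁ (() , _))
    to (inj₂ (inj₁ ((e , l) , q))) = inj₂ (inj₁ (e , q)) , labeled← l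
    to (inj₂ (inj₂ ((e , l) , s))) = inj₂ (inj₂ (e , s)) , labeled← l
    from : Strong K.E H.E (a , h) (b , h′) × Q.Labeled (b , h′) →
           Strong P.SqE H.E (inj₂ (a , u) , h) (inj₁ b , h′)
    from (s , l) = Strong-map {R = K.E} {R′ = P.SqE} {S = H.E}
      (⊥-elim ∘ labeled≢unlabeled P (labeled→ l) u ∘ sym) (_, labeled→ l) s

finite-nonempty : (H : Graph) → ∃ λ k → Graph.V H ↔ Fin (suc k)
finite-nonempty H with Graph.finite H
... | zero  , enum = ⊥-elim (¬Fin0 (Inverse.to enum (Graph.nonempty H)))
... | suc k , enum = k , enum

theorem5p6 : (G H : Graph) → IsSquare G → IsSquare (G ⊠ H)
theorem5p6 G H (P , G≅KK) =
  product , Iso-transport (Iso-⊠ H G≅KK) square↔ square-preserves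
  where open LabeledProduct P H (proj₂ (finite-nonempty H))
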